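{- Let $G$ be a graph with $m$ edges and $t$ triangles, let $\epsilon\in(0,1)$, let $\widetilde{\alpha}$ and $\widetilde{t}$ be positive integers, and set $\gamma=\max\{\widetilde{\alpha},\widetilde{t}^{1/3}\}$, $\tau_d=\frac{8m\gamma^2}{\epsilon\widetilde{t}}$, $\tau_t=12\gamma/\epsilon$. Let $H_d=\{e\in E: d(e)>\tau_d\}$ and $H_t=\{e\in E: t(e)>\tau_t\}$. If $\widetilde{\alpha}>\alpha(G)$ and $\widetilde{t}\in[t/4,t]$, then $|H_d|\le(\epsilon\widetilde{t})^{2/3}$ and $|H_t|\le(\epsilon\widetilde{t})^{2/3}$.
   Context: For an edge $e=\{u,v\}$, $d(e)=\min\{d(u),d(v)\}$ and $t(e)$ is the number of triangles containing $e$. $\alpha(G)$ is the arboricity of $G$ (minimum number of forests covering its edges).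
   Formalization: The parameter ε ranges over the rational numbers in $(0,1)$. -}

module Defs where

open import Data.Nat using (ℕ; zero; suc; _+_; _*_; _^_; _≤_; _<_; _⊓_; _<ᵇ_)
open import Data.Bool using (Bool; true; false; if_then_else_; _∧_; T)
open import Data.Fin using (Fin; zero; suc; toℕ; inject₁; fromℕ)
open import Data.List using (List; map; allFin)
open import Data.Nat.ListAction using (sum)
open import Data.Product using (Σ; _×_; ∃)
open import Relation.Binary.PropositionalEquality using (_≡_)
open import Relation.Nullary using (¬_)
open import Function.Definitions using (Injective)
import Data.Nat
import Data.Empty

record Graph (n : ℕ) : Set where
  field
    adj   : Fin n → Fin n → Bool
    sym   : ∀ u v → adj u v ≡ adj v u
    irrefl : ∀ u → adj u u ≡ false
open Graph public

sumF : {n : ℕ} → (Fin n → ℕ) → ℕ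
sumF {n} f = sum (map f (allFin n))

count : {n : ℕ} → (Fin n → Bool) → ℕ
count p = sumF (λ i → if p i then 1 else 0)

_<F_ : {n : ℕ} → Fin n → Fin n → Bool
i <F j = toℕ i <ᵇ toℕ j

edgeCount : {n : ℕ} → Graph n → ℕ
edgeCount G = sumF λ u → count λ v → (u <F v) ∧ adj G u v

triangleCount : {n : ℕ} → Graph n → ℕ
triangleCount G = sumF λ u → sumF λ v → count λ w →
  (u <F v) ∧ (v <F w) ∧ adj G u v ∧ adj G v w ∧ adj G u w

degree : {n : ℕ} → Graph n → Fin n → ℕ
degree G u = count λ v → adj G u v

edgeDeg : {n : ℕ} → Graph n → Fin n → Fin n → ℕ
edgeDeg G u v = degree G u ⊓ degree G v

edgeTri : {n : ℕ} → Graph n → Fin n → Fin n → ℕ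
edgeTri G u v = count λ w → adj G u w ∧ adj G v w

edgeCountWith : {n : ℕ} → Graph n → (Fin n → Fin n → Bool) → ℕ
edgeCountWith G P = sumF λ u → count λ v → (u <F v) ∧ adj G u v ∧ P u v

HasCycle : {n : ℕ} → (Fin n → Fin n → Bool) → Set
HasCycle {n} F = Σ ℕ λ k → Σ (Fin (suc (suc (suc k))) → Fin n) λ f →
  Injective _≡_ _≡_ f
  × (∀ (i : Fin (suc (suc k))) → T (F (f (inject₁ i)) (f (suc i))))
  × T (F (f (fromℕ (suc (suc k)))) (f zero))

-- the edges of G can be covered by k forests: a colouring of the edges
-- with k colours (symmetric on edges) whose colour classes are acyclic
-- (colour classes may be empty, so this means "at most k forests")
CoverableByForests : {n : ℕ} → Graph n → ℕ → Set
CoverableByForests {n} G k =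
  Σ (Fin n → Fin n → Fin k) λ c →
    (∀ u v → T (adj G u v) → c u v ≡ c v u)
    × (∀ (i : Fin k) → ¬ HasCycle (λ u v → adj G u v ∧ (toℕ (c u v) Data.Nat.≡ᵇ toℕ i)))

-- α(G) < a  ⇔  α(G) ≤ a - 1  ⇔  G is covered by a - 1 forests  (for a ≥ 1)
ArboricityLessThan : {n : ℕ} → Graph n → ℕ → Set
ArboricityLessThan G zero = Data.Empty.⊥
ArboricityLessThan G (suc a) = CoverableByForests G a

-- Thresholds, with ε = p / q (0 < p < q), γ = max{α̃, t̃^{1/3}}.
-- All comparisons involving γ, 1/ε, cube roots are cleared of denominators
-- and roots (all quantities are nonnegative), so they are exact over ℕ.

-- c · γ < x, where γ = max{α̃, t̃^{1/3}}:  c·α̃ < x  and  c³·t̃ < x³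
gammaBelow : (α̃ t̃ c x : ℕ) → Bool
gammaBelow α̃ t̃ c x = (c * α̃ <ᵇ x) ∧ ((c ^ 3) * t̃ <ᵇ x ^ 3)

-- c · γ² < x:  c·α̃² < x  and  c³·t̃² < x³
gammaSqBelow : (α̃ t̃ c x : ℕ) → Bool
gammaSqBelow α̃ t̃ c x = (c * α̃ ^ 2 <ᵇ x) ∧ ((c ^ 3) * t̃ ^ 2 <ᵇ x ^ 3)

-- e ∈ H_d :  d(e) > τ_d = 8 m γ² / (ε t̃),  i.e.  d(e)·p·t̃ > (8 m q)·γ²
inHd : {n : ℕ} → Graph n → (α̃ t̃ p q : ℕ) → Fin n → Fin n → Bool
inHd G α̃ t̃ p q u v =
  gammaSqBelow α̃ t̃ (8 * edgeCount G * q) (edgeDeg G u v * p * t̃)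

-- e ∈ H_t :  t(e) > τ_t = 12 γ / ε,  i.e.  t(e)·p > (12 q)·γ
inHt : {n : ℕ} → Graph n → (α̃ t̃ p q : ℕ) → Fin n → Fin n → Bool
inHt G α̃ t̃ p q u v = gammaBelow α̃ t̃ (12 * q) (edgeTri G u v * p)

-- h ≤ (ε t̃)^{2/3} with ε = p/q :  h³ · q² ≤ (p · t̃)²
BoundedByEpsT23 : (h t̃ p q : ℕ) → Set
BoundedByEpsT23 h t̃ p q = h ^ 3 * q ^ 2 ≤ (p * t̃) ^ 2

{-# OPTIONS --safe #-}
-- An edge of H_d has both endpoints of degree > τ_d, and the degrees sum to at most 2m, so
-- fewer than 2m/τ_d ≤ ε t̃^{1/3}/4 vertices are that heavy and |H_d| ≤ (ε t̃^{1/3}/4)².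
-- Summing t(e) over the edges counts every triangle three times, so by Markov's inequality
-- |H_t| ≤ 3t/τ_t ≤ ε t̃^{2/3}. Both bounds are at most (ε t̃)^{2/3} since ε < 1.
-- Over ℕ a threshold "x > c·t̃^{j/3}" reads N < x³ with N = c³·t̃ʲ, and Markov's inequality
-- is applied with the least such x, suc (iroot 3 N), as the common lower bound.
module Submission where

open import Defs hiding (sym)
open import Data.Nat
  using (ℕ; zero; suc; _+_; _*_; _^_; _≤_; _<_; _<ᵇ_; _≤?_; z≤n; s≤s; NonZero; >-nonZero)
open import Data.Nat.Properties
open import Data.Nat.Solver using (module +-*-Solver)
open import Data.Bool using (Bool; true; false; if_then_else_; _∧_; T)
open import Data.Bool.Properties using (T-∧; T-≡)
open import Data.Empty using (⊥-elim)
open import Data.Fin using (Fin; zero; suc; toℕ)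
open import Data.Fin.Properties using (toℕ-injective)
open import Data.List using (tabulate)
open import Data.List.Properties using (map-tabulate)
import Data.Nat.ListAction as List
open import Data.Product using (_×_; _,_; proj₁; proj₂)
open import Function using (_∘_; id; Equivalence)
open import Relation.Nullary using (yes; no)
open import Relation.Binary using (tri<; tri≈; tri>)
open import Relation.Binary.PropositionalEquality
open import Algebra.Properties.Semiring.Sum +-*-semiring
  using (sum; sum-cong-≗; ∑-distrib-+; ∑-comm; *-distribˡ-sum; *-distribʳ-sum)

open +-*-Solver using (solve; _:+_; _:*_; _:^_; _:=_; con)

list-sum-tabulate : ∀ {n} (f : Fin n → ℕ) → List.sum (tabulate f) ≡ sum f
list-sum-tabulate {zero}  f = refl
list-sum-tabulate {suc n} f = cong (f zero +_) (list-sum-tabulate (f ∘ suc))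

sumF≡sum : ∀ {n} (f : Fin n → ℕ) → sumF f ≡ sum f
sumF≡sum f = trans (cong List.sum (map-tabulate id f)) (list-sum-tabulate f)

sum-mono-≤ : ∀ {n} {f g : Fin n → ℕ} → (∀ i → f i ≤ g i) → sum f ≤ sum g
sum-mono-≤ {zero}  f≤g = z≤n
sum-mono-≤ {suc n} f≤g = +-mono-≤ (f≤g zero) (sum-mono-≤ (f≤g ∘ suc))

module _ {n : ℕ} where

  sumF-cong : {f g : Fin n → ℕ} → (∀ i → f i ≡ g i) → sumF f ≡ sumF g
  sumF-cong {f} {g} f≗g = trans (sumF≡sum f) (trans (sum-cong-≗ f≗g) (sym (sumF≡sum g)))

  sumF-mono-≤ : {f g : Fin n → ℕ} → (∀ i → f i ≤ g i) → sumF f ≤ sumF g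
  sumF-mono-≤ {f} {g} f≤g = subst₂ _≤_ (sym (sumF≡sum f)) (sym (sumF≡sum g)) (sum-mono-≤ f≤g)

  sumF-distrib-+ : (f g : Fin n → ℕ) → sumF (λ i → f i + g i) ≡ sumF f + sumF g
  sumF-distrib-+ f g = trans (sumF≡sum (λ i → f i + g i))
    (trans (∑-distrib-+ f g) (sym (cong₂ _+_ (sumF≡sum f) (sumF≡sum g))))

  *-distribˡ-sumF : (c : ℕ) (f : Fin n → ℕ) → c * sumF f ≡ sumF (λ i → c * f i)
  *-distribˡ-sumF c f = trans (cong (c *_) (sumF≡sum f))
    (trans (*-distribˡ-sum c f) (sym (sumF≡sum (λ i → c * f i))))

  *-distribʳ-sumF : (c : ℕ) (f : Fin n → ℕ) → sumF f * c ≡ sumF (λ i → f i * c)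
  *-distribʳ-sumF c f = trans (cong (_* c) (sumF≡sum f))
    (trans (*-distribʳ-sum c f) (sym (sumF≡sum (λ i → f i * c))))

sumF-comm : ∀ {m n} (f : Fin m → Fin n → ℕ) →
  sumF (λ i → sumF (f i)) ≡ sumF (λ j → sumF (λ i → f i j))
sumF-comm f = trans (sumF²≡∑∑ f) (trans (∑-comm f) (sym (sumF²≡∑∑ (λ j i → f i j))))
  where
  sumF²≡∑∑ : ∀ {m n} (g : Fin m → Fin n → ℕ) → sumF (λ i → sumF (g i)) ≡ sum (λ i → sum (g i))
  sumF²≡∑∑ g = trans (sumF≡sum (λ i → sumF (g i))) (sum-cong-≗ (λ i → sumF≡sum (g i)))

𝟙 : Bool → ℕ
𝟙 b = if b then 1 else 0

𝟙-∧ : ∀ a b → 𝟙 (a ∧ b) ≡ 𝟙 a * 𝟙 b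
𝟙-∧ false b = refl
𝟙-∧ true  b = sym (+-identityʳ (𝟙 b))

𝟙-mono : ∀ {a b} → (T a → T b) → 𝟙 a ≤ 𝟙 b
𝟙-mono {false}         _   = z≤n
𝟙-mono {true}  {true}  _   = ≤-refl
𝟙-mono {true}  {false} a⇒b = ⊥-elim (a⇒b _)

𝟙-markov : ∀ {b y x} → (T b → y ≤ x) → 𝟙 b * y ≤ x
𝟙-markov {false} _ = z≤n
𝟙-markov {true} {y} {x} y≤x = subst (_≤ x) (sym (*-identityˡ y)) (y≤x _)

𝟙-∧-markov : ∀ a b {c y x} → (T c → y ≤ x) → 𝟙 (a ∧ b ∧ c) * y ≤ 𝟙 (a ∧ b) * x
𝟙-∧-markov false _     _   = z≤n
𝟙-∧-markov true  false _   = z≤n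
𝟙-∧-markov true  true  {x = x} y≤x = subst (_ ≤_) (sym (*-identityˡ x)) (𝟙-markov y≤x)

T-∧∧⇒ʳ : ∀ a b {c} → T (a ∧ b ∧ c) → T c
T-∧∧⇒ʳ true  true  c = c
T-∧∧⇒ʳ true  false ()
T-∧∧⇒ʳ false _     ()

count*≤sumF : ∀ {n} {P : Fin n → Bool} {x : Fin n → ℕ} y →
  (∀ i → T (P i) → y ≤ x i) → count P * y ≤ sumF x
count*≤sumF {P = P} {x} y above = begin
  count P * y              ≡⟨ *-distribʳ-sumF y (𝟙 ∘ P) ⟩
  sumF (λ i → 𝟙 (P i) * y) ≤⟨ sumF-mono-≤ (λ i → 𝟙-markov (above i)) ⟩
  sumF x                   ∎
  where open ≤-Reasoning

<F-true : ∀ {n} {u v : Fin n} → toℕ u < toℕ v → (u <F v) ≡ true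
<F-true u<v = Equivalence.to T-≡ (<⇒<ᵇ u<v)

module _ {n : ℕ} (G : Graph n) where

  edge< : Fin n → Fin n → Bool
  edge< u v = (u <F v) ∧ adj G u v

  edgeSum : (Fin n → Fin n → ℕ) → ℕ
  edgeSum f = sumF λ u → sumF λ v → 𝟙 (edge< u v) * f u v

  triangle : Fin n → Fin n → Fin n → ℕ
  triangle u v w = 𝟙 ((u <F v) ∧ (v <F w) ∧ adj G u v ∧ adj G v w ∧ adj G u w)

  loopless : ∀ {u v} → toℕ u ≡ toℕ v → adj G u v ≢ true
  loopless {u} u≡v uv with toℕ-injective u≡v
  ... | refl with () ← trans (sym uv) (irrefl G u)

  adj≤edge<+edge> : ∀ u v → 𝟙 (adj G u v) ≤ 𝟙 (edge< u v) + 𝟙 (edge< v u)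
  adj≤edge<+edge> u v with <-cmp (toℕ u) (toℕ v)
  ... | tri< u<v _ _ rewrite <F-true u<v = m≤m+n _ _
  ... | tri> _ _ v<u rewrite <F-true v<u | Graph.sym G v u = m≤n+m _ _
  ... | tri≈ _ u≡v _ with adj G u v in uv
  ...   | false = z≤n
  ...   | true  = ⊥-elim (loopless u≡v uv)

  sumF-degree≤2*edgeCount : sumF (degree G) ≤ 2 * edgeCount G
  sumF-degree≤2*edgeCount = begin
    sumF (degree G)
      ≤⟨ sumF-mono-≤ (λ u → sumF-mono-≤ (adj≤edge<+edge> u)) ⟩
    sumF (λ u → sumF (λ v → 𝟙 (edge< u v) + 𝟙 (edge< v u)))
      ≡⟨ sumF-cong (λ u → sumF-distrib-+ (𝟙 ∘ edge< u) (λ v → 𝟙 (edge< v u))) ⟩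
    sumF (λ u → sumF (𝟙 ∘ edge< u) + sumF (λ v → 𝟙 (edge< v u)))
      ≡⟨ sumF-distrib-+ (λ u → sumF (𝟙 ∘ edge< u)) (λ u → sumF (λ v → 𝟙 (edge< v u))) ⟩
    m + sumF (λ u → sumF (λ v → 𝟙 (edge< v u)))
      ≡⟨ cong (m +_) (sumF-comm (λ u v → 𝟙 (edge< v u))) ⟩
    m + m
      ≡⟨ cong (m +_) (+-identityʳ m) ⟨
    2 * m ∎
    where
    open ≤-Reasoning
    m = edgeCount G

  -- The three triangles on the right put w last, in the middle, or first.
  edge-triangles≤ : ∀ u v w → 𝟙 (edge< u v) * 𝟙 (adj G u w ∧ adj G v w)
                              ≤ triangle u v w + triangle u w v + triangle w u v
  edge-triangles≤ u v w rewrite Graph.sym G w u | Graph.sym G w v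
    with u <F v | adj G u v | adj G u w in uw | adj G v w in vw
  ... | false | _     | _     | _     = z≤n
  ... | true  | false | _     | _     = z≤n
  ... | true  | true  | false | _     = z≤n
  ... | true  | true  | true  | false = z≤n
  ... | true  | true  | true  | true  with <-cmp (toℕ v) (toℕ w)
  ...   | tri< v<w _ _ rewrite <F-true v<w = s≤s z≤n
  ...   | tri≈ _ v≡w _ = ⊥-elim (loopless v≡w vw)
  ...   | tri> _ _ w<v with <-cmp (toℕ u) (toℕ w)
  ...     | tri< u<w _ _ rewrite <F-true u<w | <F-true w<v =
              ≤-trans (m≤n+m 1 (𝟙 ((v <F w) ∧ true))) (m≤m+n _ (𝟙 ((w <F u) ∧ true)))
  ...     | tri≈ _ u≡w _ = ⊥-elim (loopless u≡w uw)
  ...     | tri> _ _ w<u rewrite <F-true w<u = m≤n+m 1 _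

  edgeSum-edgeTri≤3*triangleCount : edgeSum (edgeTri G) ≤ 3 * triangleCount G
  edgeSum-edgeTri≤3*triangleCount = begin
    edgeSum (edgeTri G)
      ≡⟨ sumF-cong (λ u → sumF-cong (λ v →
           *-distribˡ-sumF (𝟙 (edge< u v)) (λ w → 𝟙 (adj G u w ∧ adj G v w)))) ⟩
    sumF³ (λ u v w → 𝟙 (edge< u v) * 𝟙 (adj G u w ∧ adj G v w))
      ≤⟨ sumF-mono-≤ (λ u → sumF-mono-≤ (λ v → sumF-mono-≤ (edge-triangles≤ u v))) ⟩
    sumF³ (λ u v w → triangle u v w + triangle u w v + triangle w u v)
      ≡⟨ sumF³-distrib-+ (λ u v w → triangle u v w + triangle u w v) (λ u v w → triangle w u v) ⟩
    sumF³ (λ u v w → triangle u v w + triangle u w v) + sumF³ (λ u v w → triangle w u v)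
      ≡⟨ cong (_+ sumF³ (λ u v w → triangle w u v))
              (sumF³-distrib-+ triangle (λ u v w → triangle u w v)) ⟩
    t + sumF³ (λ u v w → triangle u w v) + sumF³ (λ u v w → triangle w u v)
      ≡⟨ cong₂ (λ a b → t + a + b) swap-vw rotate ⟩
    t + t + t
      ≡⟨ solve 1 (λ t → t :+ t :+ t := con 3 :* t) refl t ⟩
    3 * t ∎
    where
    open ≤-Reasoning
    t = triangleCount G

    sumF³ : (Fin n → Fin n → Fin n → ℕ) → ℕ
    sumF³ f = sumF λ u → sumF λ v → sumF λ w → f u v w

    sumF³-distrib-+ : ∀ f g → sumF³ (λ u v w → f u v w + g u v w) ≡ sumF³ f + sumF³ g
    sumF³-distrib-+ f g = begin-equality
      sumF (λ u → sumF (λ v → sumF (λ w → f u v w + g u v w)))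
        ≡⟨ sumF-cong (λ u → sumF-cong (λ v → sumF-distrib-+ (f u v) (g u v))) ⟩
      sumF (λ u → sumF (λ v → sumF (f u v) + sumF (g u v)))
        ≡⟨ sumF-cong (λ u → sumF-distrib-+ (λ v → sumF (f u v)) (λ v → sumF (g u v))) ⟩
      sumF (λ u → sumF (λ v → sumF (f u v)) + sumF (λ v → sumF (g u v)))
        ≡⟨ sumF-distrib-+ (λ u → sumF (λ v → sumF (f u v))) (λ u → sumF (λ v → sumF (g u v))) ⟩
      sumF³ f + sumF³ g ∎

    swap-vw : sumF³ (λ u v w → triangle u w v) ≡ t
    swap-vw = sumF-cong (λ u → sumF-comm (λ v w → triangle u w v))

    rotate : sumF³ (λ u v w → triangle w u v) ≡ t
    rotate = trans (sumF-cong (λ u → sumF-comm (λ v w → triangle w u v)))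
                   (sumF-comm (λ u w → sumF (triangle w u)))

  edgeCountWith*≤edgeSum : ∀ {P f} y → (∀ u v → T (P u v) → y ≤ f u v) →
    edgeCountWith G P * y ≤ edgeSum f
  edgeCountWith*≤edgeSum {P} {f} y above = begin
    edgeCountWith G P * y
      ≡⟨ *-distribʳ-sumF y (λ u → count (λ v → (u <F v) ∧ adj G u v ∧ P u v)) ⟩
    sumF (λ u → count (λ v → (u <F v) ∧ adj G u v ∧ P u v) * y)
      ≡⟨ sumF-cong (λ u → *-distribʳ-sumF y (λ v → 𝟙 ((u <F v) ∧ adj G u v ∧ P u v))) ⟩
    sumF (λ u → sumF (λ v → 𝟙 ((u <F v) ∧ adj G u v ∧ P u v) * y))
      ≤⟨ sumF-mono-≤ (λ u → sumF-mono-≤ (λ v → 𝟙-∧-markov (u <F v) (adj G u v) (above u v))) ⟩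
    edgeSum f ∎
    where open ≤-Reasoning

  edgeSum-*ʳ : ∀ f c → edgeSum (λ u v → f u v * c) ≡ edgeSum f * c
  edgeSum-*ʳ f c = begin
    sumF (λ u → sumF (λ v → 𝟙 (edge< u v) * (f u v * c)))
      ≡⟨ sumF-cong (λ u → sumF-cong (λ v → *-assoc (𝟙 (edge< u v)) (f u v) c)) ⟨
    sumF (λ u → sumF (λ v → 𝟙 (edge< u v) * f u v * c))
      ≡⟨ sumF-cong (λ u → *-distribʳ-sumF c (λ v → 𝟙 (edge< u v) * f u v)) ⟨
    sumF (λ u → sumF (λ v → 𝟙 (edge< u v) * f u v) * c)
      ≡⟨ *-distribʳ-sumF c (λ u → sumF (λ v → 𝟙 (edge< u v) * f u v)) ⟨
    edgeSum f * c ∎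
    where open ≡-Reasoning

  edgeCountWith≤count*count : ∀ {P S} → (∀ u v → T (P u v) → T (S u) × T (S v)) →
    edgeCountWith G P ≤ count S * count S
  edgeCountWith≤count*count {P} {S} ends = begin
    edgeCountWith G P
      ≤⟨ sumF-mono-≤ (λ u → sumF-mono-≤ (λ v → both-ends u v)) ⟩
    sumF (λ u → sumF (λ v → 𝟙 (S u) * 𝟙 (S v)))
      ≡⟨ sumF-cong (λ u → *-distribˡ-sumF (𝟙 (S u)) (𝟙 ∘ S)) ⟨
    sumF (λ u → 𝟙 (S u) * count S)
      ≡⟨ *-distribʳ-sumF (count S) (𝟙 ∘ S) ⟨
    count S * count S ∎
    where
    open ≤-Reasoning
    both-ends : ∀ u v → 𝟙 ((u <F v) ∧ adj G u v ∧ P u v) ≤ 𝟙 (S u) * 𝟙 (S v)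
    both-ends u v = subst (_ ≤_) (𝟙-∧ (S u) (S v))
      (𝟙-mono (Equivalence.from T-∧ ∘ ends u v ∘ T-∧∧⇒ʳ (u <F v) (adj G u v)))

iroot : (k : ℕ) .{{_ : NonZero k}} → ℕ → ℕ
iroot k zero = 0
iroot k (suc n) with suc (iroot k n) ^ k ≤? suc n
... | yes _ = suc (iroot k n)
... | no  _ = iroot k n

iroot-spec : ∀ k .{{_ : NonZero k}} n → iroot k n ^ k ≤ n × n < suc (iroot k n) ^ k
iroot-spec (suc k) zero = z≤n , m^n>0 1 (suc k)
iroot-spec k (suc n) with suc (iroot k n) ^ k ≤? suc n | iroot-spec k n
... | yes r+1^k≤n+1 | _ , n<r+1^k =
  r+1^k≤n+1 , ≤-<-trans n<r+1^k (^-monoˡ-< k (n<1+n (suc (iroot k n))))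
... | no  r+1^k≰n+1 | r^k≤n , _ = ≤-trans r^k≤n (n≤1+n n) , ≰⇒> r+1^k≰n+1

<suc-iroot^ : ∀ k .{{_ : NonZero k}} n → n < suc (iroot k n) ^ k
<suc-iroot^ k n = proj₂ (iroot-spec k n)

iroot< : ∀ k .{{_ : NonZero k}} {n x} → n < x ^ k → iroot k n < x
iroot< k {n} {x} n<x^k =
  ≰⇒> (λ x≤r → <⇒≱ n<x^k (≤-trans (^-monoˡ-≤ k x≤r) (proj₁ (iroot-spec k n))))

^-distribʳ-* : ∀ m n k → (m * n) ^ k ≡ m ^ k * n ^ k
^-distribʳ-* m n zero    = refl
^-distribʳ-* m n (suc k) = trans (cong (m * n *_) (^-distribʳ-* m n k))
                                 ([m*n]*[o*p]≡[m*o]*[n*p] m n (m ^ k) (n ^ k))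

m*n≤o⇒m^k*p≤o^k : ∀ {m n o p} k → m * n ≤ o → p ≤ n ^ k → m ^ k * p ≤ o ^ k
m*n≤o⇒m^k*p≤o^k {m} {n} {o} {p} k mn≤o p≤n^k = begin
  m ^ k * p     ≤⟨ *-monoʳ-≤ (m ^ k) p≤n^k ⟩
  m ^ k * n ^ k ≡⟨ ^-distribʳ-* m n k ⟨
  (m * n) ^ k   ≤⟨ ^-monoˡ-≤ k mn≤o ⟩
  o ^ k         ∎
  where open ≤-Reasoning

m*q≤p*n⇒m≤n : ∀ {m n p q} → 0 < p → p ≤ q → m * q ≤ p * n → m ≤ n
m*q≤p*n⇒m≤n {m} {n} {p} {q} 0<p p≤q mq≤pn = *-cancelˡ-≤ p {{>-nonZero 0<p}} (begin
  p * m ≤⟨ *-monoˡ-≤ m p≤q ⟩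
  q * m ≡⟨ *-comm q m ⟩
  m * q ≤⟨ mq≤pn ⟩
  p * n ∎)
  where open ≤-Reasoning

BoundedByEpsT23-anti : ∀ {h h′ t p q} → h ≤ h′ → BoundedByEpsT23 h′ t p q → BoundedByEpsT23 h t p q
BoundedByEpsT23-anti {q = q} h≤h′ = ≤-trans (*-monoˡ-≤ (q ^ 2) (^-monoˡ-≤ 3 h≤h′))

Hd-arithmetic : ∀ {k y m p q t} → 0 < p → p ≤ q → 0 < t →
  k * y ≤ 2 * m * p * t → (8 * m * q) ^ 3 * t ^ 2 < y ^ 3 → BoundedByEpsT23 (k * k) t p q
Hd-arithmetic {zero}                           _ _ _  _  _  = z≤n
Hd-arithmetic {suc _} {zero}                   _ _ _  _  ()
Hd-arithmetic {suc _} {suc _} {zero}           _ _ _  () _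
Hd-arithmetic {suc _} {suc _} {suc _} {t = zero} _ _ () _  _
Hd-arithmetic {k} {y} {m@(suc _)} {p} {q} {t@(suc _)} 0<p p≤q _ ky≤2mpt N<y³ =
  m*q≤p*n⇒m≤n (m^n>0 p {{>-nonZero 0<p}} 4) (^-monoˡ-≤ 4 p≤q) (begin
    (k * k) ^ 3 * q ^ 2 * q ^ 4
      ≡⟨ solve 2 (λ k q → (k :* k) :^ 3 :* q :^ 2 :* q :^ 4 := (k :^ 3 :* q :^ 3) :* (k :^ 3 :* q :^ 3)) refl k q ⟩
    (k ^ 3 * q ^ 3) * (k ^ 3 * q ^ 3)
      ≤⟨ *-mono-≤ k³q³≤p³t k³q³≤p³t ⟩
    (p ^ 3 * t) * (p ^ 3 * t)
      ≡⟨ solve 2 (λ p t → (p :^ 3 :* t) :* (p :^ 3 :* t) := p :^ 4 :* (p :* t) :^ 2) refl p t ⟩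
    p ^ 4 * (p * t) ^ 2 ∎)
  where
  open ≤-Reasoning
  c = 8 * (m ^ 3 * t ^ 2)
  k³q³≤p³t : k ^ 3 * q ^ 3 ≤ p ^ 3 * t
  k³q³≤p³t = ≤-trans (m≤n*m (k ^ 3 * q ^ 3) 64) (*-cancelˡ-≤ c (begin
    c * (64 * (k ^ 3 * q ^ 3))
      ≡⟨ solve 4 (λ k m q t → con 8 :* (m :^ 3 :* t :^ 2) :* (con 64 :* (k :^ 3 :* q :^ 3))
                              := k :^ 3 :* ((con 8 :* m :* q) :^ 3 :* t :^ 2)) refl k m q t ⟩
    k ^ 3 * ((8 * m * q) ^ 3 * t ^ 2)
      ≤⟨ m*n≤o⇒m^k*p≤o^k {k} {y} 3 ky≤2mpt (<⇒≤ N<y³) ⟩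
    (2 * m * p * t) ^ 3
      ≡⟨ solve 3 (λ m p t → (con 2 :* m :* p :* t) :^ 3
                            := con 8 :* (m :^ 3 :* t :^ 2) :* (p :^ 3 :* t)) refl m p t ⟩
    c * (p ^ 3 * t) ∎))

Ht-arithmetic : ∀ {h y p q t} → 0 < p → p ≤ q → 0 < t →
  h * y ≤ 12 * t * p → (12 * q) ^ 3 * t < y ^ 3 → BoundedByEpsT23 h t p q
Ht-arithmetic {t = zero} _ _ () _ _
Ht-arithmetic {h} {y} {p} {q} {t@(suc _)} 0<p p≤q _ hy≤12tp N<y³ =
  m*q≤p*n⇒m≤n 0<p p≤q (begin
    h ^ 3 * q ^ 2 * q
      ≡⟨ solve 2 (λ h q → h :^ 3 :* q :^ 2 :* q := h :^ 3 :* q :^ 3) refl h q ⟩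
    h ^ 3 * q ^ 3
      ≤⟨ h³q³≤t²p³ ⟩
    t ^ 2 * p ^ 3
      ≡⟨ solve 2 (λ p t → t :^ 2 :* p :^ 3 := p :* (p :* t) :^ 2) refl p t ⟩
    p * (p * t) ^ 2 ∎)
  where
  open ≤-Reasoning
  h³q³≤t²p³ : h ^ 3 * q ^ 3 ≤ t ^ 2 * p ^ 3
  h³q³≤t²p³ = *-cancelˡ-≤ (1728 * t) (begin
    1728 * t * (h ^ 3 * q ^ 3)
      ≡⟨ solve 3 (λ h q t → con 1728 :* t :* (h :^ 3 :* q :^ 3)
                            := h :^ 3 :* ((con 12 :* q) :^ 3 :* t)) refl h q t ⟩
    h ^ 3 * ((12 * q) ^ 3 * t)
      ≤⟨ m*n≤o⇒m^k*p≤o^k {h} {y} 3 hy≤12tp (<⇒≤ N<y³) ⟩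
    (12 * t * p) ^ 3
      ≡⟨ solve 2 (λ p t → (con 12 :* t :* p) :^ 3 := con 1728 :* t :* (t :^ 2 :* p :^ 3)) refl p t ⟩
    1728 * t * (t ^ 2 * p ^ 3) ∎)

gammaBelow⇒cube< : ∀ α̃ t̃ c x → T (gammaBelow α̃ t̃ c x) → c ^ 3 * t̃ < x ^ 3
gammaBelow⇒cube< α̃ t̃ c x below = <ᵇ⇒< (c ^ 3 * t̃) (x ^ 3) (proj₂ (Equivalence.to T-∧ below))

gammaSqBelow⇒cube< : ∀ α̃ t̃ c x → T (gammaSqBelow α̃ t̃ c x) → c ^ 3 * t̃ ^ 2 < x ^ 3
gammaSqBelow⇒cube< α̃ t̃ c x below =
  <ᵇ⇒< (c ^ 3 * t̃ ^ 2) (x ^ 3) (proj₂ (Equivalence.to T-∧ below))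

Hd-bound : ∀ {n} (G : Graph n) {p q} α̃ {t̃} → 0 < p → p ≤ q → 0 < t̃ →
  BoundedByEpsT23 (edgeCountWith G (inHd G α̃ t̃ p q)) t̃ p q
Hd-bound {n} G {p} {q} α̃ {t̃} 0<p p≤q 0<t̃ =
  BoundedByEpsT23-anti {t = t̃} {p} {q} (edgeCountWith≤count*count G heavy-ends)
    (Hd-arithmetic {count heavy} {y} {m} 0<p p≤q 0<t̃ heavy*y≤2mpt̃ (<suc-iroot^ 3 N))
  where
  open ≤-Reasoning
  m = edgeCount G
  N = (8 * m * q) ^ 3 * t̃ ^ 2
  y = suc (iroot 3 N)

  x : Fin n → ℕ
  x v = degree G v * p * t̃

  heavy : Fin n → Bool
  heavy v = N <ᵇ x v ^ 3

  heavy-ends : ∀ u v → T (inHd G α̃ t̃ p q u v) → T (heavy u) × T (heavy v)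
  heavy-ends u v uv∈Hd = heavy-if (m⊓n≤m _ _) , heavy-if (m⊓n≤n _ _)
    where
    heavy-if : ∀ {w} → edgeDeg G u v ≤ degree G w → T (heavy w)
    heavy-if d≤ = <⇒<ᵇ (<-≤-trans
      (gammaSqBelow⇒cube< α̃ t̃ (8 * m * q) (edgeDeg G u v * p * t̃) uv∈Hd)
      (^-monoˡ-≤ 3 (*-monoˡ-≤ t̃ (*-monoˡ-≤ p d≤))))

  heavy*y≤2mpt̃ : count heavy * y ≤ 2 * m * p * t̃
  heavy*y≤2mpt̃ = begin
    count heavy * y
      ≤⟨ count*≤sumF y (λ v → iroot< 3 ∘ <ᵇ⇒< N (x v ^ 3)) ⟩
    sumF x
      ≡⟨ *-distribʳ-sumF t̃ (λ v → degree G v * p) ⟨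
    sumF (λ v → degree G v * p) * t̃
      ≡⟨ cong (_* t̃) (*-distribʳ-sumF p (degree G)) ⟨
    sumF (degree G) * p * t̃
      ≤⟨ *-monoˡ-≤ t̃ (*-monoˡ-≤ p (sumF-degree≤2*edgeCount G)) ⟩
    2 * m * p * t̃ ∎

Ht-bound : ∀ {n} (G : Graph n) {p q} α̃ {t̃} → 0 < p → p ≤ q → 0 < t̃ →
  triangleCount G ≤ 4 * t̃ → BoundedByEpsT23 (edgeCountWith G (inHt G α̃ t̃ p q)) t̃ p q
Ht-bound G {p} {q} α̃ {t̃} 0<p p≤q 0<t̃ t≤4t̃ =
  Ht-arithmetic {|Ht|} {y} 0<p p≤q 0<t̃ |Ht|*y≤12t̃p (<suc-iroot^ 3 N)
  where
  open ≤-Reasoning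
  |Ht| = edgeCountWith G (inHt G α̃ t̃ p q)
  N = (12 * q) ^ 3 * t̃
  y = suc (iroot 3 N)

  |Ht|*y≤12t̃p : |Ht| * y ≤ 12 * t̃ * p
  |Ht|*y≤12t̃p = begin
    |Ht| * y
      ≤⟨ edgeCountWith*≤edgeSum G y (λ u v →
           iroot< 3 ∘ gammaBelow⇒cube< α̃ t̃ (12 * q) (edgeTri G u v * p)) ⟩
    edgeSum G (λ u v → edgeTri G u v * p)
      ≡⟨ edgeSum-*ʳ G (edgeTri G) p ⟩
    edgeSum G (edgeTri G) * p
      ≤⟨ *-monoˡ-≤ p (edgeSum-edgeTri≤3*triangleCount G) ⟩
    3 * triangleCount G * p
      ≤⟨ *-monoˡ-≤ p (*-monoʳ-≤ 3 t≤4t̃) ⟩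
    3 * (4 * t̃) * p
      ≡⟨ cong (_* p) (*-assoc 3 4 t̃) ⟨
    12 * t̃ * p ∎

claim3p4 : {n : ℕ} (G : Graph n) (p q α̃ t̃ : ℕ) →
    0 < p → p < q → 0 < α̃ → 0 < t̃ →
    ArboricityLessThan G α̃ →
    triangleCount G ≤ 4 * t̃ → t̃ ≤ triangleCount G →
    BoundedByEpsT23 (edgeCountWith G (inHd G α̃ t̃ p q)) t̃ p q
    × BoundedByEpsT23 (edgeCountWith G (inHt G α̃ t̃ p q)) t̃ p q
claim3p4 G p q α̃ t̃ 0<p p<q _ 0<t̃ _ t≤4t̃ _ =
  Hd-bound G α̃ 0<p (<⇒≤ p<q) 0<t̃ , Ht-bound G α̃ 0<p (<⇒≤ p<q) 0<t̃ t≤4t̃
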